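{- A digraph is a hero in orientations of unit interval graphs if and only if it is a hero in tournaments.
   Context: A unit interval graph is a graph admitting an interval representation in which every interval has length 1. An orientation of a graph gives each edge exactly one direction. The dichromatic number of a digraph is the least number of parts in a partition of its vertex set into sets inducing acyclic subdigraphs. A digraph $H$ is a hero in a class $\mathcal{C}$ of digraphs if there is a constant $c$ such that every digraph in $\mathcal{C}$ with no induced subdigraph isomorphic to $H$ has dichromatic number at most $c$; heroes in tournaments are heroes in the class of tournaments.
   Formalization: The intervals in a unit interval representation have rational endpoints. -}

module Defs where

open import Data.Nat using (ℕ; zero; suc)
open import Data.Fin using (Fin; zero; suc; inject₁; fromℕ)
open import Data.Bool using (Bool; true; false)
open import Data.Product using (Σ; ∃; _×_; _,_)
open import Data.Sum using (_⊎_)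
open import Data.Rational using (ℚ; ∣_∣; _-_; _≤_; 1ℚ)
open import Relation.Binary.PropositionalEquality using (_≡_)
open import Relation.Nullary using (¬_)
open import Function.Bundles using (_⇔_)

record Digraph : Set where
  field
    n        : ℕ
    arc      : Fin n → Fin n → Bool
    loopless : ∀ v → arc v v ≡ false
open Digraph public

InducedIn : Digraph → Digraph → Set
InducedIn H G =
  Σ (Fin (n H) → Fin (n G)) λ f →
    (∀ u v → f u ≡ f v → u ≡ v) ×
    (∀ u v → arc H u v ≡ arc G (f u) (f v))

-- A directed cycle of length k (k ≥ 1) in G with all vertices in S:
-- c 0 → c 1 → … → c k = c 0, with c 0, …, c (k-1) pairwise distinct.
record CycleIn (G : Digraph) (S : Fin (n G) → Set) : Set where
  field
    k        : ℕ
    c        : Fin (suc (suc k)) → Fin (n G)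
    closed   : c zero ≡ c (fromℕ (suc k))
    arcs     : ∀ (i : Fin (suc k)) → arc G (c (inject₁ i)) (c (suc i)) ≡ true
    distinct : ∀ (i j : Fin (suc k)) → c (inject₁ i) ≡ c (inject₁ j) → i ≡ j
    inS      : ∀ i → S (c i)

Acyclic : (G : Digraph) → (Fin (n G) → Set) → Set
Acyclic G S = ¬ CycleIn G S

DichromaticAtMost : ℕ → Digraph → Set
DichromaticAtMost c G =
  Σ (Fin (n G) → Fin c) λ col → ∀ (i : Fin c) → Acyclic G (λ v → col v ≡ i)

IsTournament : Digraph → Set
IsTournament G = ∀ u v → ¬ (u ≡ v) →
  ((arc G u v ≡ true) × (arc G v u ≡ false)) ⊎
  ((arc G u v ≡ false) × (arc G v u ≡ true))

IsOriented : Digraph → Set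
IsOriented G = ∀ u v → arc G u v ≡ true → arc G v u ≡ false

Adj : (G : Digraph) → Fin (n G) → Fin (n G) → Set
Adj G u v = (arc G u v ≡ true) ⊎ (arc G v u ≡ true)

-- The underlying graph is a unit interval graph: vertex v gets the closed
-- interval [x v, x v + 1]; distinct u, v adjacent iff intervals intersect.
UnderlyingUnitInterval : Digraph → Set
UnderlyingUnitInterval G =
  Σ (Fin (n G) → ℚ) λ x → ∀ u v → ¬ (u ≡ v) →
    Adj G u v ⇔ (∣ x u - x v ∣ ≤ 1ℚ)

IsOrientationOfUnitInterval : Digraph → Set
IsOrientationOfUnitInterval G = IsOriented G × UnderlyingUnitInterval G

HeroIn : (Digraph → Set) → Digraph → Set
HeroIn 𝒞 H = Σ ℕ λ c → ∀ (G : Digraph) → 𝒞 G → ¬ InducedIn H G →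
  DichromaticAtMost c G

-- A tournament orients a complete graph, which is a unit interval graph (all
-- intervals equal), so a hero in orientations of unit interval graphs is a hero in
-- tournaments.  Conversely, let G be an H-free orientation of a unit interval graph
-- with intervals [x v, x v + 1].  Vertices with the same ⌊x v⌋ are pairwise
-- adjacent, so each such block induces an H-free tournament, which can be coloured
-- with c colours.  Adjacent vertices have floors differing by at most one, so no
-- arc joins two distinct blocks whose floors have the same parity.  Hence pairing
-- the block colour of a vertex with the parity of its floor gives 2c colours, and
-- a monochromatic directed cycle would lie inside a single block.

module Submission where

open import Defs
open import Function.Bundles using (_⇔_; mk⇔; Equivalence)

open import Data.Nat using (zero; suc; _*_; parity)
open import Data.Fin using (Fin; zero; suc; inject₁; combine)
open import Data.Fin.Properties using (combine-injective; combine-surjective)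
open import Data.Bool using (true)
open import Data.Product using (Σ; _×_; _,_; proj₁; proj₂)
open import Data.Sum using (inj₁; inj₂; [_,_]′; swap)
open import Data.List using (List; length; lookup; filter; allFin)
open import Data.List.Relation.Unary.All as All using ()
open import Data.List.Relation.Unary.All.Properties using (all-filter)
open import Data.List.Relation.Unary.Any as Any using ()
open import Data.List.Relation.Unary.Any.Properties using (lookup-index)
open import Data.List.Relation.Unary.AllPairs using (_∷_)
open import Data.List.Relation.Unary.Unique.Propositional using (Unique)
open import Data.List.Relation.Unary.Unique.Propositional.Properties using (allFin⁺; filter⁺)
open import Data.List.Membership.Propositional.Properties using (∈-filter⁺; ∈-allFin; ∈-lookup)
open import Data.Integer as ℤ using (ℤ; +_; -[1+_]; 1ℤ)
import Data.Integer.Properties as ℤ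
open import Data.Integer.DivMod using ([n/d]*d≤n; n<s[n/ℕd]*d; div-pos-is-/ℕ)
open import Data.Parity using (Parity; 0ℙ; 1ℙ; _⁻¹)
open import Data.Parity.Properties using (⁻¹-selfInverse; suc-homo-⁻¹; p≢p⁻¹)
open import Data.Rational as ℚ
  using (ℚ; mkℚ; _+_; _-_; -_; ∣_∣; _≤_; _<_; 0ℚ; 1ℚ; floor; ↥_; ↧_; *≤*; *<*)
open import Data.Rational.Literals using (fromℤ)
import Data.Rational.Properties as ℚ
import Data.Rational.Unnormalised as ℚᵘ
import Data.Rational.Unnormalised.Properties as ℚᵘ
open import Data.Rational.Solver using (module +-*-Solver)
open import Level using (0ℓ)
open import Relation.Unary using (Pred; Decidable; _⊆_)
open import Relation.Binary.Definitions using (DecidableEquality; tri<; tri≈; tri>)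
open import Relation.Nullary using (contradiction)
open import Relation.Binary.PropositionalEquality
open import Function using (_∘_)

lookup-injective : ∀ {A : Set} {xs : List A} → Unique xs →
  ∀ i j → lookup xs i ≡ lookup xs j → i ≡ j
lookup-injective (_ ∷ _)      zero    zero    _  = refl
lookup-injective (x∉xs ∷ _)   zero    (suc j) eq = contradiction eq (All.lookup x∉xs (∈-lookup j))
lookup-injective (x∉xs ∷ _)   (suc i) zero    eq = contradiction (sym eq) (All.lookup x∉xs (∈-lookup i))
lookup-injective (_ ∷ unique) (suc i) (suc j) eq = cong suc (lookup-injective unique i j eq)

InducedIn-trans : ∀ {H K G} → InducedIn H K → InducedIn K G → InducedIn H G
InducedIn-trans (f , f-injective , f-arc) (g , g-injective , g-arc) =
  g ∘ f , (λ u v eq → f-injective u v (g-injective (f u) (f v) eq)) ,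
  (λ u v → trans (f-arc u v) (g-arc (f u) (f v)))

arc⇒≢ : ∀ (G : Digraph) {u v} → arc G u v ≡ true → u ≢ v
arc⇒≢ G {u} uv refl = contradiction (trans (sym uv) (loopless G u)) λ ()

module _ {G : Digraph} where

  restrict-cycle : ∀ {S T : Pred (Fin (n G)) 0ℓ} (C : CycleIn G S) →
    (∀ t → T (CycleIn.c C t)) → CycleIn G T
  restrict-cycle C inT = record
    { k = k ; c = c ; closed = closed ; arcs = arcs ; distinct = distinct ; inS = inT }
    where open CycleIn C

  cycle-mono : ∀ {S T : Pred (Fin (n G)) 0ℓ} → S ⊆ T → CycleIn G S → CycleIn G T
  cycle-mono S⊆T C = restrict-cycle C (S⊆T ∘ CycleIn.inS C)

  stepwise-constant : ∀ {A : Set} {m} (f : Fin (suc m) → A) →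
    (∀ i → f (inject₁ i) ≡ f (suc i)) → ∀ t → f t ≡ f zero
  stepwise-constant         f step zero    = refl
  stepwise-constant {m = suc m} f step (suc t) =
    trans (stepwise-constant (f ∘ suc) (step ∘ suc) t) (sym (step zero))

  cycle-constant : ∀ {A : Set} {S : Pred (Fin (n G)) 0ℓ} (f : Fin (n G) → A) →
    (∀ {u v} → S u → S v → arc G u v ≡ true → f u ≡ f v) →
    (C : CycleIn G S) → ∀ t → f (CycleIn.c C t) ≡ f (CycleIn.c C zero)
  cycle-constant f f-arc C =
    stepwise-constant (f ∘ c) λ i → f-arc (inS (inject₁ i)) (inS (suc i)) (arcs i)
    where open CycleIn C

  acyclic-if-blocks-acyclic : ∀ {A : Set} (S : Pred (Fin (n G)) 0ℓ) (block : Fin (n G) → A) →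
    (∀ {u v} → S u → S v → arc G u v ≡ true → block u ≡ block v) →
    (∀ a → Acyclic G (λ v → S v × block v ≡ a)) → Acyclic G S
  acyclic-if-blocks-acyclic S block block-arc acyclic C =
    acyclic _ (restrict-cycle C λ t → CycleIn.inS C t , cycle-constant block block-arc C t)

module _ (G : Digraph) {P : Pred (Fin (n G)) 0ℓ} (P? : Decidable P) where

  private
    members : List (Fin (n G))
    members = filter P? (allFin (n G))

  induced : Digraph
  induced = record
    { n        = length members
    ; arc      = λ i j → arc G (lookup members i) (lookup members j)
    ; loopless = λ i → loopless G (lookup members i)
    }

  embed : Fin (n induced) → Fin (n G)
  embed = lookup members

  embed-injective : ∀ i j → embed i ≡ embed j → i ≡ j
  embed-injective = lookup-injective (filter⁺ P? (allFin⁺ (n G)))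

  P-embed : ∀ i → P (embed i)
  P-embed i = All.lookup (all-filter P? (allFin (n G))) (∈-lookup i)

  index : ∀ {v} → P v → Fin (n induced)
  index {v} Pv = Any.index (∈-filter⁺ P? (∈-allFin v) Pv)

  embed-index : ∀ {v} (Pv : P v) → embed (index Pv) ≡ v
  embed-index {v} Pv = sym (lookup-index (∈-filter⁺ P? (∈-allFin v) Pv))

  index-embed : ∀ i (Pi : P (embed i)) → index Pi ≡ i
  index-embed i Pi = embed-injective _ _ (embed-index Pi)

  induced-InducedIn : InducedIn induced G
  induced-InducedIn = embed , embed-injective , λ _ _ → refl

  lift-cycle : ∀ {S} (C : CycleIn G S) → (∀ t → P (CycleIn.c C t)) → CycleIn induced (S ∘ embed)
  lift-cycle {S} C inP = record
    { k        = k
    ; c        = c′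
    ; closed   = embed-injective _ _ (trans (embed-c′ _) (trans closed (sym (embed-c′ _))))
    ; arcs     = λ i → trans (cong₂ (arc G) (embed-c′ _) (embed-c′ _)) (arcs i)
    ; distinct = λ i j eq → distinct i j (trans (sym (embed-c′ _)) (trans (cong embed eq) (embed-c′ _)))
    ; inS      = λ t → subst S (sym (embed-c′ t)) (inS t)
    }
    where
    open CycleIn C
    c′ : Fin (suc (suc k)) → Fin (n induced)
    c′ = index ∘ inP
    embed-c′ : ∀ t → embed (c′ t) ≡ c t
    embed-c′ = embed-index ∘ inP

  induced-tournament : IsOriented G → (∀ {u v} → P u → P v → u ≢ v → Adj G u v) →
    IsTournament induced
  induced-tournament oriented clique i j i≢j
    with clique (P-embed i) (P-embed j) (i≢j ∘ embed-injective i j)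
  ... | inj₁ ij = inj₁ (ij , oriented _ _ ij)
  ... | inj₂ ji = inj₂ (oriented _ _ ji , ji)

product-colouring : ∀ {k c} (G : Digraph) (p : Fin (n G) → Fin k) (g : Fin (n G) → Fin c) →
  (∀ j i → Acyclic G (λ v → p v ≡ j × g v ≡ i)) → DichromaticAtMost (k * c) G
product-colouring {k} {c} G p g acyclic = (λ v → combine (p v) (g v)) , class-acyclic
  where
  class-acyclic : ∀ l → Acyclic G (λ v → combine (p v) (g v) ≡ l)
  class-acyclic l C with combine-surjective {k} {c} l
  ... | j , i , refl = acyclic j i (cycle-mono (combine-injective _ _ j i) C)

blockwise-colouring : ∀ {c} {A : Set} (G : Digraph) (block : Fin (n G) → A) (_≟_ : DecidableEquality A) →
  (∀ a → DichromaticAtMost c (induced G (λ v → block v ≟ a))) →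
  Σ (Fin (n G) → Fin c) λ g → ∀ i a → Acyclic G (λ v → g v ≡ i × block v ≡ a)
blockwise-colouring {c} G block _≟_ χ = g , acyclic
  where
  colour : ∀ a → Fin (n (induced G (λ v → block v ≟ a))) → Fin c
  colour a = proj₁ (χ a)

  g : Fin (n G) → Fin c
  g v = colour (block v) (index G (λ v → block v ≟ _) refl)

  colour-index : ∀ {v a} (q : block v ≡ a) → colour a (index G (λ v → block v ≟ a) q) ≡ g v
  colour-index refl = refl

  colour-embed : ∀ {a} i → colour a i ≡ g (embed G (λ v → block v ≟ a) i)
  colour-embed {a} i = trans (cong (colour a) (sym (index-embed G _ i in-a))) (colour-index in-a)
    where
    in-a : block (embed G (λ v → block v ≟ a) i) ≡ a
    in-a = P-embed G (λ v → block v ≟ a) i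

  acyclic : ∀ i a → Acyclic G (λ v → g v ≡ i × block v ≡ a)
  acyclic i a C = proj₂ (χ a) i
    (cycle-mono (λ {j} (gj≡i , _) → trans (colour-embed j) gj≡i)
                (lift-cycle G _ C (proj₂ ∘ CycleIn.inS C)))

parity-∣suc∣ : ∀ z → parity ℤ.∣ ℤ.suc z ∣ ≡ parity ℤ.∣ z ∣ ⁻¹
parity-∣suc∣ (+ n)          = sym (⁻¹-selfInverse (suc-homo-⁻¹ n))
parity-∣suc∣ -[1+ 0 ]       = refl
parity-∣suc∣ -[1+ suc n ]   = sym (⁻¹-selfInverse (suc-homo-⁻¹ n))

parity-∣suc∣-≢ : ∀ z → parity ℤ.∣ z ∣ ≢ parity ℤ.∣ ℤ.suc z ∣
parity-∣suc∣-≢ z eq = p≢p⁻¹ _ (trans eq (parity-∣suc∣ z))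

i≤1+j∧j≤1+i∧same-parity⇒i≡j : ∀ {i j} → i ℤ.≤ ℤ.suc j → j ℤ.≤ ℤ.suc i →
  parity ℤ.∣ i ∣ ≡ parity ℤ.∣ j ∣ → i ≡ j
i≤1+j∧j≤1+i∧same-parity⇒i≡j {i} {j} i≤1+j j≤1+i same with ℤ.<-cmp i j
... | tri≈ _ i≡j _ = i≡j
... | tri< i<j _ _ =
  contradiction (trans same (cong (parity ∘ ℤ.∣_∣) j≡1+i)) (parity-∣suc∣-≢ i)
  where
  j≡1+i : j ≡ ℤ.suc i
  j≡1+i = ℤ.≤-antisym j≤1+i (ℤ.i<j⇒suc[i]≤j i<j)
... | tri> _ _ j<i =
  contradiction (trans (sym same) (cong (parity ∘ ℤ.∣_∣) i≡1+j)) (parity-∣suc∣-≢ j)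
  where
  i≡1+j : i ≡ ℤ.suc j
  i≡1+j = ℤ.≤-antisym i≤1+j (ℤ.i<j⇒suc[i]≤j j<i)

fromℤ-homo-+ : ∀ a b → fromℤ (a ℤ.+ b) ≡ fromℤ a + fromℤ b
fromℤ-homo-+ a b = ℚ.toℚᵘ-injective
  (ℚᵘ.≃-trans (ℚᵘ.*≡* (cong (ℤ._* 1ℤ) (cong₂ ℤ._+_ (sym (ℤ.*-identityʳ a))
                                                    (sym (ℤ.*-identityʳ b)))))
              (ℚᵘ.≃-sym (ℚ.toℚᵘ-homo-+ (fromℤ a) (fromℤ b))))

fromℤ-cancel-< : ∀ {a b} → fromℤ a < fromℤ b → a ℤ.< b
fromℤ-cancel-< {a} {b} (*<* a<b) = subst₂ ℤ._<_ (ℤ.*-identityʳ a) (ℤ.*-identityʳ b) a<b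

fromℤ⌊p⌋≤p : ∀ p → fromℤ ⌊ p ⌋ ≤ p
fromℤ⌊p⌋≤p p@record{} =
  *≤* (ℤ.≤-trans ([n/d]*d≤n (↥ p) (↧ p)) (ℤ.≤-reflexive (sym (ℤ.*-identityʳ (↥ p)))))

p<1+fromℤ⌊p⌋ : ∀ p → p < 1ℚ + fromℤ ⌊ p ⌋
p<1+fromℤ⌊p⌋ p@(mkℚ num d-1 _) = subst (p <_) (fromℤ-homo-+ 1ℤ ⌊ p ⌋) (*<*
  (subst₂ ℤ._<_ (sym (ℤ.*-identityʳ num))
                (cong (λ q → ℤ.suc q ℤ.* + suc d-1) (sym (div-pos-is-/ℕ num (suc d-1))))
                (n<s[n/ℕd]*d num (suc d-1))))

p≤∣p∣ : ∀ p → p ≤ ∣ p ∣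
p≤∣p∣ p = [ (λ p≤0 → ℚ.≤-trans p≤0 (ℚ.0≤∣p∣ p))
          , (λ 0≤p → ℚ.≤-reflexive (sym (ℚ.0≤p⇒∣p∣≡p 0≤p)))
          ]′ (ℚ.≤-total p 0ℚ)

-p≤∣p∣ : ∀ p → - p ≤ ∣ p ∣
-p≤∣p∣ p = subst (- p ≤_) (ℚ.∣-p∣≡∣p∣ p) (p≤∣p∣ (- p))

p≤q∧-p≤q⇒∣p∣≤q : ∀ {p q} → p ≤ q → - p ≤ q → ∣ p ∣ ≤ q
p≤q∧-p≤q⇒∣p∣≤q {p} p≤q -p≤q with ℚ.∣p∣≡p∨∣p∣≡-p p
... | inj₁ ∣p∣≡p  = subst (_≤ _) (sym ∣p∣≡p) p≤q
... | inj₂ ∣p∣≡-p = subst (_≤ _) (sym ∣p∣≡-p) -p≤q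

open +-*-Solver

∣p-q∣≤r⇒q≤r+p : ∀ {p q r} → ∣ p - q ∣ ≤ r → q ≤ r + p
∣p-q∣≤r⇒q≤r+p {p} {q} {r} h = begin
  q               ≡⟨ solve 2 (λ p q → q := :- (p :- q) :+ p) refl p q ⟩
  - (p - q) + p   ≤⟨ ℚ.+-monoˡ-≤ p (ℚ.≤-trans (-p≤∣p∣ (p - q)) h) ⟩
  r + p           ∎
  where open ℚ.≤-Reasoning

p≤r+q⇒p-q≤r : ∀ {p q r} → p ≤ r + q → p - q ≤ r
p≤r+q⇒p-q≤r {p} {q} {r} h = begin
  p - q           ≤⟨ ℚ.+-monoˡ-≤ (- q) h ⟩
  r + q - q       ≡⟨ solve 2 (λ q r → r :+ q :- q := r) refl q r ⟩
  r               ∎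
  where open ℚ.≤-Reasoning

p≤r+q∧q≤r+p⇒∣p-q∣≤r : ∀ {p q r} → p ≤ r + q → q ≤ r + p → ∣ p - q ∣ ≤ r
p≤r+q∧q≤r+p⇒∣p-q∣≤r {p} {q} p≤r+q q≤r+p = p≤q∧-p≤q⇒∣p∣≤q
  (p≤r+q⇒p-q≤r p≤r+q)
  (subst (ℚ._≤ _) (solve 2 (λ p q → q :- p := :- (p :- q)) refl p q) (p≤r+q⇒p-q≤r q≤r+p))

⌊p⌋≡⌊q⌋⇒p≤1+q : ∀ {p q} → ⌊ p ⌋ ≡ ⌊ q ⌋ → p ≤ 1ℚ + q
⌊p⌋≡⌊q⌋⇒p≤1+q {p} {q} eq = begin
  p                  <⟨ p<1+fromℤ⌊p⌋ p ⟩
  1ℚ + fromℤ ⌊ p ⌋   ≡⟨ cong (λ z → 1ℚ + fromℤ z) eq ⟩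
  1ℚ + fromℤ ⌊ q ⌋   ≤⟨ ℚ.+-monoʳ-≤ 1ℚ (fromℤ⌊p⌋≤p q) ⟩
  1ℚ + q             ∎
  where open ℚ.≤-Reasoning

p≤1+q⇒⌊p⌋≤1+⌊q⌋ : ∀ {p q} → p ≤ 1ℚ + q → ⌊ p ⌋ ℤ.≤ ℤ.suc ⌊ q ⌋
p≤1+q⇒⌊p⌋≤1+⌊q⌋ {p} {q} h = subst (⌊ p ⌋ ℤ.≤_) (ℤ.pred-suc (ℤ.suc ⌊ q ⌋))
  (ℤ.i<j⇒i≤pred[j] (fromℤ-cancel-< (begin-strict
    fromℤ ⌊ p ⌋                       ≤⟨ fromℤ⌊p⌋≤p p ⟩
    p                                 ≤⟨ h ⟩
    1ℚ + q                            <⟨ ℚ.+-monoʳ-< 1ℚ (p<1+fromℤ⌊p⌋ q) ⟩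
    1ℚ + (1ℚ + fromℤ ⌊ q ⌋)           ≡⟨ cong (_+_ 1ℚ) (sym (fromℤ-homo-+ 1ℤ ⌊ q ⌋)) ⟩
    1ℚ + fromℤ (ℤ.suc ⌊ q ⌋)          ≡⟨ sym (fromℤ-homo-+ 1ℤ (ℤ.suc ⌊ q ⌋)) ⟩
    fromℤ (ℤ.suc (ℤ.suc ⌊ q ⌋))       ∎)))
  where open ℚ.≤-Reasoning

toFin : Parity → Fin 2
toFin 0ℙ = zero
toFin 1ℙ = suc zero

toFin-injective : ∀ {p q} → toFin p ≡ toFin q → p ≡ q
toFin-injective {0ℙ} {0ℙ} _ = refl
toFin-injective {1ℙ} {1ℙ} _ = refl

module UnitIntervalBlocks (G : Digraph) (x : Fin (n G) → ℚ)
  (intersect : ∀ u v → u ≢ v → Adj G u v ⇔ (∣ x u - x v ∣ ≤ 1ℚ)) where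

  block : Fin (n G) → ℤ
  block v = ⌊ x v ⌋

  same-block⇒adjacent : ∀ {u v} → u ≢ v → block u ≡ block v → Adj G u v
  same-block⇒adjacent {u} {v} u≢v eq = Equivalence.from (intersect u v u≢v)
    (p≤r+q∧q≤r+p⇒∣p-q∣≤r (⌊p⌋≡⌊q⌋⇒p≤1+q {x u} {x v} eq)
                         (⌊p⌋≡⌊q⌋⇒p≤1+q {x v} {x u} (sym eq)))

  adjacent⇒block-≤-suc : ∀ {u v} → u ≢ v → Adj G u v → block v ℤ.≤ ℤ.suc (block u)
  adjacent⇒block-≤-suc {u} {v} u≢v adj =
    p≤1+q⇒⌊p⌋≤1+⌊q⌋ {x v} {x u}
      (∣p-q∣≤r⇒q≤r+p {x u} {x v} (Equivalence.to (intersect u v u≢v) adj))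

  adjacent-same-parity⇒same-block : ∀ {u v} → u ≢ v → Adj G u v →
    parity ℤ.∣ block u ∣ ≡ parity ℤ.∣ block v ∣ → block u ≡ block v
  adjacent-same-parity⇒same-block u≢v adj =
    i≤1+j∧j≤1+i∧same-parity⇒i≡j (adjacent⇒block-≤-suc (u≢v ∘ sym) (swap adj))
                                  (adjacent⇒block-≤-suc u≢v adj)

dichromaticAtMost-2*-from-subtournaments : ∀ {c} (G : Digraph) → IsOrientationOfUnitInterval G →
  (∀ {P : Pred (Fin (n G)) 0ℓ} (P? : Decidable P) →
     IsTournament (induced G P?) → DichromaticAtMost c (induced G P?)) →
  DichromaticAtMost (2 * c) G
dichromaticAtMost-2*-from-subtournaments {c} G (oriented , x , intersect) χ =
  product-colouring G parity-class g class-acyclic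
  where
  open UnitIntervalBlocks G x intersect

  parity-class : Fin (n G) → Fin 2
  parity-class = toFin ∘ parity ∘ ℤ.∣_∣ ∘ block

  colouring : Σ (Fin (n G) → Fin c) λ g → ∀ i a → Acyclic G (λ v → g v ≡ i × block v ≡ a)
  colouring = blockwise-colouring G block ℤ._≟_ λ a →
    χ (in-block a) (induced-tournament G (in-block a) oriented
                      λ bu bv u≢v → same-block⇒adjacent u≢v (trans bu (sym bv)))
    where
    in-block : ∀ a → Decidable (λ v → block v ≡ a)
    in-block a v = block v ℤ.≟ a

  g : Fin (n G) → Fin c
  g = proj₁ colouring

  g-acyclic : ∀ i a → Acyclic G (λ v → g v ≡ i × block v ≡ a)
  g-acyclic = proj₂ colouring

  same-class⇒same-block : ∀ j i {u v} →
    parity-class u ≡ j × g u ≡ i → parity-class v ≡ j × g v ≡ i →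
    arc G u v ≡ true → block u ≡ block v
  same-class⇒same-block j i (pu≡j , _) (pv≡j , _) uv =
    adjacent-same-parity⇒same-block (arc⇒≢ G uv) (inj₁ uv) (toFin-injective (trans pu≡j (sym pv≡j)))

  class-acyclic : ∀ j i → Acyclic G (λ v → parity-class v ≡ j × g v ≡ i)
  class-acyclic j i =
    acyclic-if-blocks-acyclic (λ v → parity-class v ≡ j × g v ≡ i) block
      (same-class⇒same-block j i)
      λ a C → g-acyclic i a (cycle-mono (λ where ((_ , gv≡i) , bv≡a) → gv≡i , bv≡a) C)

tournament⇒oriented : ∀ G → IsTournament G → IsOriented G
tournament⇒oriented G tournament u v uv with tournament u v (arc⇒≢ G uv)
... | inj₁ (_ , vu-false) = vu-false
... | inj₂ (uv-false , _) = contradiction (trans (sym uv) uv-false) λ ()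

tournament⇒adjacent : ∀ G → IsTournament G → ∀ u v → u ≢ v → Adj G u v
tournament⇒adjacent G tournament u v u≢v with tournament u v u≢v
... | inj₁ (uv , _) = inj₁ uv
... | inj₂ (_ , vu) = inj₂ vu

tournament⇒orientationOfUnitInterval : ∀ G → IsTournament G → IsOrientationOfUnitInterval G
tournament⇒orientationOfUnitInterval G tournament =
  tournament⇒oriented G tournament , (λ _ → 0ℚ) ,
  λ u v u≢v → mk⇔ (λ _ → ℚ.≤ᵇ⇒≤ _) (λ _ → tournament⇒adjacent G tournament u v u≢v)

HeroIn-antitone : ∀ {𝒞 𝒟 : Digraph → Set} {H} →
  (∀ G → 𝒞 G → 𝒟 G) → HeroIn 𝒟 H → HeroIn 𝒞 H
HeroIn-antitone 𝒞⊆𝒟 (c , χ) = c , λ G G∈𝒞 → χ G (𝒞⊆𝒟 G G∈𝒞)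

tournament-hero⇒unitInterval-hero : ∀ H → HeroIn IsTournament H → HeroIn IsOrientationOfUnitInterval H
tournament-hero⇒unitInterval-hero H (c , χ) = 2 * c , λ G G-uig H∉G →
  dichromaticAtMost-2*-from-subtournaments G G-uig λ P? T →
    χ _ T λ H⊆T → H∉G (InducedIn-trans {H} {induced G P?} {G} H⊆T (induced-InducedIn G P?))

theorem10p3p1 : (H : Digraph) →
    HeroIn IsOrientationOfUnitInterval H ⇔ HeroIn IsTournament H
theorem10p3p1 H =
  mk⇔ (HeroIn-antitone {H = H} tournament⇒orientationOfUnitInterval)
      (tournament-hero⇒unitInterval-hero H)
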